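{- Let $i$ be an agent, $G$ and $H$ groups, and $\phi$ a formula of $\mathcal{RCD}$. Then: (1) if $G\cap H=\emptyset$, then $R_GC_H\phi\leftrightarrow C_HR_G\phi$ is valid; (2) if $G\supseteq H$ and $i\in G$, then $R_GC_H\phi\leftrightarrow R_GK_i\phi$ and $R_GK_i\phi\leftrightarrow D_GR_G\phi$ are valid.
   Context: Fix a countable set $\textsc{prop}$ of propositional variables and a finite set $\textsc{ag}$ of agents; groups are nonempty subsets of $\textsc{ag}$. The language $\mathcal{RCD}$ is $\phi ::= p \mid \neg\phi \mid \phi\wedge\phi \mid K_i\phi \mid D_G\phi \mid C_G\phi \mid R_G\phi$. A model is $\mathfrak{M}=(S,\sim,V)$ with each $\sim_i$ an equivalence relation on $S$ and $V:\textsc{prop}\to 2^S$; $\sim_G=\bigcap_{i\in G}\sim_i$. The $G$-resolved update is $\mathfrak{M}|_G=(S,\sim|_G,V)$ with $(\sim|_G)_i=\sim_G$ for $i\in G$ and $\sim_i$ otherwise. Satisfaction: atoms via $V$; Booleans as usual; $K_i\phi$ at $s$ iff $\phi$ at all $t$ with $s\sim_it$; $D_G\phi$ iff $\phi$ at all $t$ with $s\sim_Gt$; $C_G\phi$ iff $\phi$ at all $t$ reachable from $s$ via the reflexive transitive closure of $\bigcup_{i\in G}\sim_i$; $\mathfrak{M},s\models R_G\phi$ iff $\mathfrak{M}|_G,s\models\phi$. Valid = true at every state of every model. -}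

module Defs where

open import Data.Nat using (ℕ)
open import Data.Fin using (Fin)
open import Data.Fin.Subset using (Subset; _∈_; _⊆_; _∩_; Nonempty; Empty)
open import Data.Product using (Σ; _×_; proj₁)
open import Relation.Nullary using (¬_)
open import Relation.Binary using (Rel; IsEquivalence)
open import Relation.Binary.Construct.Closure.ReflexiveTransitive using (Star)
open import Level using (0ℓ)

Group : ℕ → Set
Group n = Σ (Subset n) Nonempty

∣_∣ : ∀ {n} → Group n → Subset n
∣ G ∣ = proj₁ G

data Form (n : ℕ) : Set where
  var : ℕ → Form n
  ¬f_ : Form n → Form n
  _∧f_ : Form n → Form n → Form n
  K : Fin n → Form n → Form n
  D : Group n → Form n → Form n
  C : Group n → Form n → Form n
  R : Group n → Form n → Form n

_→f_ : ∀ {n} → Form n → Form n → Form n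
φ →f ψ = ¬f (φ ∧f (¬f ψ))

_↔f_ : ∀ {n} → Form n → Form n → Form n
φ ↔f ψ = (φ →f ψ) ∧f (ψ →f φ)

DistRel : ∀ {n} {S : Set} → (Fin n → Rel S 0ℓ) → Subset n → Rel S 0ℓ
DistRel r G s t = ∀ i → i ∈ G → r i s t

UnionRel : ∀ {n} {S : Set} → (Fin n → Rel S 0ℓ) → Subset n → Rel S 0ℓ
UnionRel r G s t = Σ _ (λ i → i ∈ G × r i s t)

resolve : ∀ {n} {S : Set} → (Fin n → Rel S 0ℓ) → Subset n → Fin n → Rel S 0ℓ
resolve r G i s t = (i ∈ G → DistRel r G s t) × (¬ (i ∈ G) → r i s t)

record Model (n : ℕ) : Set₁ where
  field
    S     : Set
    rel   : Fin n → Rel S 0ℓ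
    equiv : ∀ i → IsEquivalence (rel i)
    V     : ℕ → S → Set

sat : ∀ {n} {S : Set} → (Fin n → Rel S 0ℓ) → (ℕ → S → Set) → S → Form n → Set
sat r V s (var p) = V p s
sat r V s (¬f φ) = ¬ sat r V s φ
sat r V s (φ ∧f ψ) = sat r V s φ × sat r V s ψ
sat r V s (K i φ) = ∀ t → r i s t → sat r V t φ
sat r V s (D G φ) = ∀ t → DistRel r ∣ G ∣ s t → sat r V t φ
sat r V s (C G φ) = ∀ t → Star (UnionRel r ∣ G ∣) s t → sat r V t φ
sat r V s (R G φ) = sat (resolve r ∣ G ∣) V s φ

_,_⊨_ : ∀ {n} (M : Model n) → Model.S M → Form n → Set
M , s ⊨ φ = sat (Model.rel M) (Model.V M) s φ

Valid : ∀ {n} → Form n → Set₁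
Valid {n} φ = ∀ (M : Model n) (s : Model.S M) → M , s ⊨ φ

-- Updating with G does not touch the relations of agents outside G, so when G and H are
-- disjoint the H-reachability relation is the same before and after the update. When
-- H ⊆ G, every agent of H (and i) sees exactly ∼_G after the update; since ∼_G is an
-- equivalence relation, reachability along these steps collapses to ∼_G itself, so after
-- the update C_H, K_i and the outer D_G all quantify over the same ∼_G-class.
module Submission where

open import Defs
open import Data.Nat using (ℕ)
open import Data.Fin using (Fin)
open import Data.Fin.Subset using (_∈_; _⊆_; _∩_; Empty)
open import Data.Fin.Subset.Properties using (x∈p∩q⁺)
open import Data.Product using (_×_; _,_; proj₁; proj₂)
open import Data.Empty using (⊥-elim)
open import Relation.Nullary using (¬_)
open import Relation.Binary using (Rel; IsEquivalence; _⇔_)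
open import Relation.Binary.Construct.Closure.ReflexiveTransitive as Star using (Star; ε; _◅_)
open import Level using (0ℓ)

-- The conclusion is how `sat` unfolds (□ φ) ↔f (□′ φ) for boxes along P and Q.
□-cong : ∀ {S : Set} {P Q : Rel S 0ℓ} {A : S → Set} {s : S} → P ⇔ Q →
         ¬ ((∀ t → P s t → A t) × ¬ (∀ t → Q s t → A t)) × ¬ ((∀ t → Q s t → A t) × ¬ (∀ t → P s t → A t))
□-cong (P⇒Q , Q⇒P) = (λ (□ᴾA , ¬□ᵠA) → ¬□ᵠA λ t q → □ᴾA t (Q⇒P q))
                    , (λ (□ᵠA , ¬□ᴾA) → ¬□ᴾA λ t p → □ᵠA t (P⇒Q p))

module _ {n : ℕ} {S : Set} (r : Fin n → Rel S 0ℓ) where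

  DistRel-isEquivalence : (∀ i → IsEquivalence (r i)) → ∀ G → IsEquivalence (DistRel r G)
  DistRel-isEquivalence equiv G = record
    { refl  = λ i _ → IsEquivalence.refl (equiv i)
    ; sym   = λ p i i∈G → IsEquivalence.sym (equiv i) (p i i∈G)
    ; trans = λ p q i i∈G → IsEquivalence.trans (equiv i) (p i i∈G) (q i i∈G)
    }

  resolve-∈⇔DistRel : ∀ {G i} → i ∈ G → resolve r G i ⇔ DistRel r G
  resolve-∈⇔DistRel i∈G = (λ rr → proj₁ rr i∈G) , (λ d → (λ _ → d) , (λ i∉G → ⊥-elim (i∉G i∈G)))

  resolve-∉⇔ : ∀ {G i} → ¬ i ∈ G → resolve r G i ⇔ r i
  resolve-∉⇔ i∉G = (λ rr → proj₂ rr i∉G) , (λ ri → (λ i∈G → ⊥-elim (i∉G i∈G)) , (λ _ → ri))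

  Star-UnionRel-resolve-disjoint : ∀ {G H} → Empty (G ∩ H) →
                                   Star (UnionRel (resolve r G) H) ⇔ Star (UnionRel r H)
  Star-UnionRel-resolve-disjoint {G} {H} G∩H≡∅ =
      Star.map (λ (j , j∈H , rr) → j , j∈H , proj₁ (resolve-∉⇔ (j∉G j∈H)) rr)
    , Star.map (λ (j , j∈H , rj) → j , j∈H , proj₂ (resolve-∉⇔ (j∉G j∈H)) rj)
    where
    j∉G : ∀ {j} → j ∈ H → ¬ j ∈ G
    j∉G j∈H j∈G = G∩H≡∅ (_ , x∈p∩q⁺ (j∈G , j∈H))

  Star-UnionRel-resolve⇔DistRel : (∀ i → IsEquivalence (r i)) → ∀ {G H h} → h ∈ H → H ⊆ G →
                                  Star (UnionRel (resolve r G) H) ⇔ DistRel r G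
  Star-UnionRel-resolve⇔DistRel equiv {G} h∈H H⊆G =
      Star.fold (DistRel r G) (λ (j , j∈H , rr) → trans (proj₁ (resolve-∈⇔DistRel (H⊆G j∈H)) rr)) refl
    , (λ d → (_ , h∈H , proj₂ (resolve-∈⇔DistRel (H⊆G h∈H)) d) ◅ ε)
    where open IsEquivalence (DistRel-isEquivalence equiv G)

  Star-UnionRel-resolve⇔resolve-∈ : (∀ i → IsEquivalence (r i)) → ∀ {G H h i} → h ∈ H → H ⊆ G → i ∈ G →
                                    Star (UnionRel (resolve r G) H) ⇔ resolve r G i
  Star-UnionRel-resolve⇔resolve-∈ equiv h∈H H⊆G i∈G =
      (λ c → proj₂ (resolve-∈⇔DistRel i∈G) (proj₁ (Star-UnionRel-resolve⇔DistRel equiv h∈H H⊆G) c))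
    , (λ k → proj₂ (Star-UnionRel-resolve⇔DistRel equiv h∈H H⊆G) (proj₁ (resolve-∈⇔DistRel i∈G) k))

proposition4 : ∀ {n : ℕ} (i : Fin n) (G H : Group n) (φ : Form n)
    → (Empty (∣ G ∣ ∩ ∣ H ∣) → Valid ((R G (C H φ)) ↔f (C H (R G φ))))
    × ((∣ H ∣ ⊆ ∣ G ∣) → i ∈ ∣ G ∣
       → Valid ((R G (C H φ)) ↔f (R G (K i φ))) × Valid ((R G (K i φ)) ↔f (D G (R G φ))))
proposition4 i G (_ , h , h∈H) φ =
    (λ G∩H≡∅ M s → □-cong (Star-UnionRel-resolve-disjoint (Model.rel M) G∩H≡∅))
  , (λ H⊆G i∈G → (λ M s → □-cong (Star-UnionRel-resolve⇔resolve-∈ (Model.rel M) (Model.equiv M) h∈H H⊆G i∈G))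
                , (λ M s → □-cong (resolve-∈⇔DistRel (Model.rel M) i∈G)))
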